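{- Let $n$ be an odd positive integer, $S=\{0,\dots,n-1\}$, and let $\alpha_1,\alpha_2,\alpha_3\in\{1,\dots,n-1\}$. Define the $n\times n\times n$ array $C$ by $C_{ijk}\equiv\alpha_1 i+\alpha_2 j+\alpha_3 k\pmod n$, $i,j,k\in S$, $C_{ijk}\in S$. Suppose, with $A=\alpha_1+\alpha_2+\alpha_3$: $\gcd(\alpha_\ell,n)=1$ for $\ell=1,2,3$; $\gcd(\alpha_\ell+\alpha_{\ell'},n)=1$ and $\gcd(\alpha_\ell-\alpha_{\ell'},n)=1$ for all $\ell\ne\ell'$ in $\{1,2,3\}$; $\gcd(A,n)=1$; and $\gcd(A-2\alpha_\ell,n)=1$ for $\ell=1,2,3$. Then $C$ is a pandiagonal latin cube.
   Context: An $n\times n$ array $(A_{xy})_{x,y\in S}$ with entries in $S$ is a pandiagonal latin square if for each $c\in S$ each of the index sets $\{(x,c)\}_x$, $\{(c,y)\}_y$, $\{(x,x+c\bmod n)\}_x$, $\{(x,c-x\bmod n)\}_x$ contains each element of $S$ exactly once among its entries. The $3n+6$ constituent squares of an $n\times n\times n$ array $C$ are: the $3n$ squares obtained by fixing one of $i,j,k$ to a value in $S$ (indexed by the other two coordinates), and the six diagonal squares $(C_{iik})_{i,k}$, $(C_{i,n-1-i,k})_{i,k}$, $(C_{iji})_{i,j}$, $(C_{i,j,n-1-i})_{i,j}$, $(C_{ijj})_{i,j}$, $(C_{i,j,n-1-j})_{i,j}$. $C$ (with entries in $S$) is a pandiagonal latin cube if each of its $3n+6$ constituent squares is a pandiagonal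 latin square. -}

module Defs where

open import Data.Nat using (ℕ; suc; _+_; _*_; _%_; NonZero)
open import Data.Nat.DivMod using (m%n<n)
open import Data.Fin using (Fin; toℕ; fromℕ<; opposite)
open import Data.Product using (_×_; ∃)
open import Relation.Binary.PropositionalEquality using (_≡_)

modN : (n : ℕ) → .{{_ : NonZero n}} → ℕ → Fin n
modN n m = fromℕ< (m%n<n m n)

_⊕_ : {n : ℕ} → .{{_ : NonZero n}} → Fin n → Fin n → Fin n
_⊕_ {n} x c = modN n (toℕ x + toℕ c)

-- c - x mod n  (computed as c + (n - x), which is ≡ c - x mod n)
_⊖_ : {n : ℕ} → .{{_ : NonZero n}} → Fin n → Fin n → Fin n
_⊖_ {n} c x = modN n (toℕ c + (n Data.Nat.∸ toℕ x))

ExactlyOnce : {n : ℕ} → (Fin n → Fin n) → Set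
ExactlyOnce {n} f = ∀ (s : Fin n) → ∃ λ x → f x ≡ s × (∀ y → f y ≡ s → y ≡ x)

Square : ℕ → Set
Square n = Fin n → Fin n → Fin n

Cube : ℕ → Set
Cube n = Fin n → Fin n → Fin n → Fin n

PandiagonalLatinSquare : (n : ℕ) → .{{_ : NonZero n}} → Square n → Set
PandiagonalLatinSquare n A =
  ∀ (c : Fin n) →
    ExactlyOnce (λ x → A x c) ×
    ExactlyOnce (λ y → A c y) ×
    ExactlyOnce (λ x → A x (x ⊕ c)) ×
    ExactlyOnce (λ x → A x (c ⊖ x))

PandiagonalLatinCube : (n : ℕ) → .{{_ : NonZero n}} → Cube n → Set
PandiagonalLatinCube n C =
  (∀ (i : Fin n) → PandiagonalLatinSquare n (λ j k → C i j k)) ×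
  (∀ (j : Fin n) → PandiagonalLatinSquare n (λ i k → C i j k)) ×
  (∀ (k : Fin n) → PandiagonalLatinSquare n (λ i j → C i j k)) ×
  PandiagonalLatinSquare n (λ i k → C i i k) ×
  PandiagonalLatinSquare n (λ i k → C i (opposite i) k) ×
  PandiagonalLatinSquare n (λ i j → C i j i) ×
  PandiagonalLatinSquare n (λ i j → C i j (opposite i)) ×
  PandiagonalLatinSquare n (λ i j → C i j j) ×
  PandiagonalLatinSquare n (λ i j → C i j (opposite j))

linearCube : (n : ℕ) → .{{_ : NonZero n}} → ℕ → ℕ → ℕ → Cube n
linearCube n a₁ a₂ a₃ i j k = modN n (a₁ * toℕ i + a₂ * toℕ j + a₃ * toℕ k)

-- Modulo n the cube is linear, C i j k ≡ α₁ i + α₂ j + α₃ k, and so is each constituent square: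
-- fixing one coordinate, or tying two of them together (with opposite i ≡ −1 − i), leaves an
-- affine form p x + q y + r.  Its rows, columns, broken diagonals and broken antidiagonals are
-- then affine maps S → S of slopes p, q, p + q and p − q, and an affine map whose slope is prime
-- to n is injective, hence bijective.  Up to sign, these slopes are exactly the quantities that
-- the hypotheses declare prime to n.
module Submission where

open import Defs
open import Data.Empty using (⊥-elim)
open import Data.Fin using (Fin; toℕ; opposite; punchOut)
open import Data.Fin.Properties using (any?; _≟_; punchOut-injective; <⇒notInjective)
open import Data.Integer using (ℤ; +_; ∣_∣) renaming (_+_ to _+ℤ_; _-_ to _-ℤ_; _*_ to _*ℤ_)
open import Data.Nat using (ℕ; suc; _≤_; _<_; NonZero)
open import Data.Nat.Divisibility using (_∣_)
open import Data.Nat.GCD using (gcd)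
open import Data.Nat.Properties using (n<1+n)
open import Data.Product using (_,_)
open import Function.Definitions using (Injective)
open import Relation.Binary.PropositionalEquality using (_≡_; _≢_; sym; trans)
open import Relation.Nullary using (¬_; yes; no)

injective⇒exactlyOnce : ∀ {n} {f : Fin n → Fin n} → Injective _≡_ _≡_ f → ExactlyOnce f
injective⇒exactlyOnce {suc m} {f} f-inj s with any? (λ x → f x ≟ s)
... | yes (x , fx≡s) = x , fx≡s , λ y fy≡s → f-inj (trans fy≡s (sym fx≡s))
... | no s∉image = ⊥-elim (<⇒notInjective (n<1+n m) g-injective)
  where
  s≢f : ∀ x → s ≢ f x
  s≢f x s≡fx = s∉image (x , sym s≡fx)

  g : Fin (suc m) → Fin m
  g x = punchOut (s≢f x)

  g-injective : Injective _≡_ _≡_ g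
  g-injective {x} {y} gx≡gy = f-inj (punchOut-injective (s≢f x) (s≢f y) gx≡gy)

module Modulo (n : ℕ) .{{_ : NonZero n}} where

  open import Data.Integer using (-_; _+_; _-_; _*_; 0ℤ; 1ℤ; -1ℤ)
  import Data.Nat as ℕ
  import Data.Nat.Properties as ℕ
  import Data.Integer.Properties as ℤ
  import Data.Integer.Divisibility.Signed as ℤ∣
  open import Data.Integer.Tactic.RingSolver using (solve-∀; solve)
  open import Data.List using (_∷_; [])
  open import Data.Nat.DivMod using (_%_; _/_; m%n<n; m≡m%n+[m/n]*n; m<n⇒m%n≡m)
  open import Data.Nat.Divisibility using (n∣m⇒m%n≡0)
  import Data.Nat.Coprimality as ℕ
  open import Data.Nat.GCD using (gcd-comm)
  open import Data.Fin.Properties using (toℕ-injective; toℕ<n; toℕ-fromℕ<; opposite-prop)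
  open import Relation.Binary.PropositionalEquality using (refl; cong; cong₂; subst)
  open import Relation.Binary.Structures using (IsEquivalence)
  open import Relation.Binary.Bundles using (Setoid)

  -- A record, so that x and y can be inferred from a proof of x ≈ y.
  infix 4 _≈_
  record _≈_ (x y : ℤ) : Set where
    constructor mod-n
    field n∣x-y : + n ℤ∣.∣ x - y

  ≡⇒≈ : ∀ {x y} → x ≡ y → x ≈ y
  ≡⇒≈ {x} refl = mod-n (ℤ∣.divides 0ℤ (ℤ.+-inverseʳ x))

  ≈-refl : ∀ {x} → x ≈ x
  ≈-refl = ≡⇒≈ refl

  ≈-sym : ∀ {x y} → x ≈ y → y ≈ x
  ≈-sym {x} {y} (mod-n d) = mod-n (subst (+ n ℤ∣.∣_) (negation x y) (ℤ∣.∣m⇒∣-m d))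
    where
    negation : ∀ x y → - (x - y) ≡ y - x
    negation = solve-∀

  ≈-trans : ∀ {x y z} → x ≈ y → y ≈ z → x ≈ z
  ≈-trans {x} {y} {z} (mod-n d) (mod-n e) =
    mod-n (subst (+ n ℤ∣.∣_) (telescope x y z) (ℤ∣.∣m∣n⇒∣m+n d e))
    where
    telescope : ∀ x y z → (x - y) + (y - z) ≡ x - z
    telescope = solve-∀

  ≈-isEquivalence : IsEquivalence _≈_
  ≈-isEquivalence = record { refl = ≈-refl ; sym = ≈-sym ; trans = ≈-trans }

  ≈-setoid : Setoid _ _
  ≈-setoid = record { isEquivalence = ≈-isEquivalence }

  +-cong : ∀ {x y u v} → x ≈ y → u ≈ v → x + u ≈ y + v
  +-cong {x} {y} {u} {v} (mod-n d) (mod-n e) =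
    mod-n (subst (+ n ℤ∣.∣_) (interchange x y u v) (ℤ∣.∣m∣n⇒∣m+n d e))
    where
    interchange : ∀ x y u v → (x - y) + (u - v) ≡ (x + u) - (y + v)
    interchange = solve-∀

  *-congˡ : ∀ a {x y} → x ≈ y → a * x ≈ a * y
  *-congˡ a {x} {y} (mod-n d) = mod-n (subst (+ n ℤ∣.∣_) (distrib a x y) (ℤ∣.∣n⇒∣m*n a d))
    where
    distrib : ∀ a x y → a * (x - y) ≡ a * x - a * y
    distrib = solve-∀

  x+q*n≈x : ∀ x q → x + q * + n ≈ x
  x+q*n≈x x q = mod-n (ℤ∣.divides q (cancel x q (+ n)))
    where
    cancel : ∀ x q N → (x + q * N) - x ≡ q * N
    cancel = solve-∀

  open import Relation.Binary.Reasoning.Setoid ≈-setoid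

  n-x≈-x : ∀ x → + n - x ≈ - x
  n-x≈-x x = begin
    + n - x            ≡⟨ ℤ.+-comm (+ n) (- x) ⟩
    - x + + n          ≡⟨ cong (_+_ (- x)) (ℤ.*-identityˡ (+ n)) ⟨
    - x + 1ℤ * + n     ≈⟨ x+q*n≈x (- x) 1ℤ ⟩
    - x                ∎

  pos-∸ : ∀ {a b} → a ℕ.≤ b → + (b ℕ.∸ a) ≡ + b - + a
  pos-∸ {a} {b} a≤b = trans (sym (ℤ.≤-⊖ a≤b)) (sym (ℤ.m-n≡m⊖n b a))

  toℤ : Fin n → ℤ
  toℤ x = + toℕ x

  toℤ-modN : ∀ k → toℤ (modN n k) ≈ + k
  toℤ-modN k = begin
    toℤ (modN n k)                ≡⟨ cong +_ (toℕ-fromℕ< (m%n<n k n)) ⟩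
    + (k % n)                     ≈⟨ ≈-sym (x+q*n≈x (+ (k % n)) (+ (k / n))) ⟩
    + (k % n) + + (k / n) * + n   ≡⟨ cong (_+_ (+ (k % n))) (ℤ.pos-* (k / n) n) ⟨
    + (k % n) + + (k / n ℕ.* n)   ≡⟨ ℤ.pos-+ (k % n) (k / n ℕ.* n) ⟨
    + (k % n ℕ.+ k / n ℕ.* n)     ≡⟨ cong +_ (m≡m%n+[m/n]*n k n) ⟨
    + k                           ∎

  toℤ-⊕ : ∀ x c → toℤ (x ⊕ c) ≈ toℤ x + toℤ c
  toℤ-⊕ x c = ≈-trans (toℤ-modN (toℕ x ℕ.+ toℕ c)) (≡⇒≈ (ℤ.pos-+ (toℕ x) (toℕ c)))

  toℤ-⊖ : ∀ c x → toℤ (c ⊖ x) ≈ toℤ c - toℤ x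
  toℤ-⊖ c x = begin
    toℤ (c ⊖ x)                      ≈⟨ toℤ-modN (toℕ c ℕ.+ (n ℕ.∸ toℕ x)) ⟩
    + (toℕ c ℕ.+ (n ℕ.∸ toℕ x))      ≡⟨ ℤ.pos-+ (toℕ c) (n ℕ.∸ toℕ x) ⟩
    toℤ c + + (n ℕ.∸ toℕ x)          ≡⟨ cong (_+_ (toℤ c)) (pos-∸ (ℕ.<⇒≤ (toℕ<n x))) ⟩
    toℤ c + (+ n - toℤ x)            ≈⟨ +-cong (≈-refl {toℤ c}) (n-x≈-x (toℤ x)) ⟩
    toℤ c - toℤ x                    ∎

  toℤ-opposite : ∀ x → toℤ (opposite x) ≈ -1ℤ - toℤ x
  toℤ-opposite x = begin
    toℤ (opposite x)                 ≡⟨ cong +_ (opposite-prop x) ⟩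
    + (n ℕ.∸ suc (toℕ x))            ≡⟨ pos-∸ (toℕ<n x) ⟩
    + n - (1ℤ + toℤ x)               ≈⟨ n-x≈-x (1ℤ + toℤ x) ⟩
    - (1ℤ + toℤ x)                   ≡⟨ ℤ.neg-distrib-+ 1ℤ (toℤ x) ⟩
    -1ℤ - toℤ x                      ∎

  Coprime : ℤ → Set
  Coprime a = gcd ∣ a ∣ n ≡ 1

  Coprime-neg : ∀ {a b} → - a ≡ b → Coprime a → Coprime b
  Coprime-neg {a} refl = subst (λ k → gcd k n ≡ 1) (sym (ℤ.∣-i∣≡∣i∣ a))

  +-cancelʳ-≈ : ∀ {x y} b → x + b ≈ y + b → x ≈ y
  +-cancelʳ-≈ {x} {y} b (mod-n d) = mod-n (subst (+ n ℤ∣.∣_) (cancel x y b) d)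
    where
    cancel : ∀ x y b → (x + b) - (y + b) ≡ x - y
    cancel = solve-∀

  *-cancelˡ-≈ : ∀ a {x y} → Coprime a → a * x ≈ a * y → x ≈ y
  *-cancelˡ-≈ a {x} {y} a⊥n (mod-n d) = mod-n (ℤ∣.∣ᵤ⇒∣ (ℕ.coprime-divisor n⊥∣a∣ n∣∣a∣*∣x-y∣))
    where
    factor : ∀ a x y → a * x - a * y ≡ a * (x - y)
    factor = solve-∀

    n⊥∣a∣ : ℕ.Coprime n ∣ a ∣
    n⊥∣a∣ = ℕ.gcd≡1⇒coprime (trans (gcd-comm n ∣ a ∣) a⊥n)

    n∣∣a∣*∣x-y∣ : n ∣ ∣ a ∣ ℕ.* ∣ x - y ∣
    n∣∣a∣*∣x-y∣ = subst (n ∣_) (ℤ.abs-* a (x - y)) (ℤ∣.∣⇒∣ᵤ (subst (+ n ℤ∣.∣_) (factor a x y) d))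

  toℤ-≈⇒≡ : ∀ {x y} → toℤ x ≈ toℤ y → x ≡ y
  toℤ-≈⇒≡ {x} {y} (mod-n d) = toℕ-injective (ℤ.+-injective (ℤ.i-j≡0⇒i≡j _ _ (ℤ.∣i∣≡0⇒i≡0 ∣x-y∣≡0)))
    where
    ∣x-y∣<n : ∣ toℤ x - toℤ y ∣ ℕ.< n
    ∣x-y∣<n = subst (ℕ._< n) (cong ∣_∣ (sym (ℤ.m-n≡m⊖n (toℕ x) (toℕ y))))
                (ℕ.≤-<-trans (ℤ.∣m⊝n∣≤m⊔n (toℕ x) (toℕ y)) (ℕ.⊔-lub (toℕ<n x) (toℕ<n y)))

    ∣x-y∣≡0 : ∣ toℤ x - toℤ y ∣ ≡ 0
    ∣x-y∣≡0 = trans (sym (m<n⇒m%n≡m ∣x-y∣<n)) (n∣m⇒m%n≡0 _ n (ℤ∣.∣⇒∣ᵤ d))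

  affine-cong : ∀ p q r {x x′ y y′} → x ≈ x′ → y ≈ y′ → p * x + q * y + r ≈ p * x′ + q * y′ + r
  affine-cong p q r x≈x′ y≈y′ = +-cong (+-cong (*-congˡ p x≈x′) (*-congˡ q y≈y′)) (≈-refl {r})

  affine⇒injective : ∀ {f : Fin n → Fin n} a b → Coprime a →
                     (∀ x → toℤ (f x) ≈ a * toℤ x + b) → Injective _≡_ _≡_ f
  affine⇒injective {f} a b a⊥n f≈ {x} {y} fx≡fy = toℤ-≈⇒≡ (*-cancelˡ-≈ a a⊥n (+-cancelʳ-≈ b (begin
    a * toℤ x + b   ≈⟨ f≈ x ⟨
    toℤ (f x)       ≡⟨ cong toℤ fx≡fy ⟩
    toℤ (f y)       ≈⟨ f≈ y ⟩
    a * toℤ y + b   ∎)))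

  affine⇒exactlyOnce : ∀ {f : Fin n → Fin n} a b → Coprime a →
                       (∀ x → toℤ (f x) ≈ a * toℤ x + b) → ExactlyOnce f
  affine⇒exactlyOnce a b a⊥n f≈ = injective⇒exactlyOnce (affine⇒injective a b a⊥n f≈)

  affine⇒pandiagonal : ∀ {A : Square n} p q r →
                       Coprime p → Coprime q → Coprime (p + q) → Coprime (p - q) →
                       (∀ x y → toℤ (A x y) ≈ p * toℤ x + q * toℤ y + r) →
                       PandiagonalLatinSquare n A
  affine⇒pandiagonal {A} p q r p⊥n q⊥n p+q⊥n p-q⊥n A≈ c =
      affine⇒exactlyOnce p (q * toℤ c + r) p⊥n column
    , affine⇒exactlyOnce q (p * toℤ c + r) q⊥n row
    , affine⇒exactlyOnce (p + q) (q * toℤ c + r) p+q⊥n diagonal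
    , affine⇒exactlyOnce (p - q) (q * toℤ c + r) p-q⊥n antidiagonal
    where
    column : ∀ x → toℤ (A x c) ≈ p * toℤ x + (q * toℤ c + r)
    column x = ≈-trans (A≈ x c) (≡⇒≈ (ℤ.+-assoc (p * toℤ x) (q * toℤ c) r))

    regroup-row : ∀ p q r x y → p * x + q * y + r ≡ q * y + (p * x + r)
    regroup-row = solve-∀

    row : ∀ y → toℤ (A c y) ≈ q * toℤ y + (p * toℤ c + r)
    row y = ≈-trans (A≈ c y) (≡⇒≈ (regroup-row p q r (toℤ c) (toℤ y)))

    regroup-diagonal : ∀ p q r x c → p * x + q * (x + c) + r ≡ (p + q) * x + (q * c + r)
    regroup-diagonal = solve-∀

    diagonal : ∀ x → toℤ (A x (x ⊕ c)) ≈ (p + q) * toℤ x + (q * toℤ c + r)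
    diagonal x = begin
      toℤ (A x (x ⊕ c))                     ≈⟨ A≈ x (x ⊕ c) ⟩
      p * toℤ x + q * toℤ (x ⊕ c) + r       ≈⟨ affine-cong p q r ≈-refl (toℤ-⊕ x c) ⟩
      p * toℤ x + q * (toℤ x + toℤ c) + r   ≡⟨ regroup-diagonal p q r (toℤ x) (toℤ c) ⟩
      (p + q) * toℤ x + (q * toℤ c + r)     ∎

    regroup-antidiagonal : ∀ p q r x c → p * x + q * (c - x) + r ≡ (p - q) * x + (q * c + r)
    regroup-antidiagonal = solve-∀

    antidiagonal : ∀ x → toℤ (A x (c ⊖ x)) ≈ (p - q) * toℤ x + (q * toℤ c + r)
    antidiagonal x = begin
      toℤ (A x (c ⊖ x))                     ≈⟨ A≈ x (c ⊖ x) ⟩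
      p * toℤ x + q * toℤ (c ⊖ x) + r       ≈⟨ affine-cong p q r ≈-refl (toℤ-⊖ c x) ⟩
      p * toℤ x + q * (toℤ c - toℤ x) + r   ≡⟨ regroup-antidiagonal p q r (toℤ x) (toℤ c) ⟩
      (p - q) * toℤ x + (q * toℤ c + r)     ∎

  module AffineCube (α₁ α₂ α₃ : ℤ) {C : Cube n}
    (C-linear : ∀ i j k → toℤ (C i j k) ≈ α₁ * toℤ i + α₂ * toℤ j + α₃ * toℤ k) where

    A : ℤ
    A = α₁ + α₂ + α₃

    C-linear-cong : ∀ {i j k I J K} → toℤ i ≈ I → toℤ j ≈ J → toℤ k ≈ K →
                    toℤ (C i j k) ≈ α₁ * I + α₂ * J + α₃ * K
    C-linear-cong {i} {j} {k} i≈I j≈J k≈K =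
      ≈-trans (C-linear i j k) (+-cong (+-cong (*-congˡ α₁ i≈I) (*-congˡ α₂ j≈J)) (*-congˡ α₃ k≈K))

    slice₁-pandiagonal : Coprime α₂ → Coprime α₃ → Coprime (α₂ + α₃) → Coprime (α₂ - α₃) →
                         ∀ i → PandiagonalLatinSquare n (λ j k → C i j k)
    slice₁-pandiagonal c₂ c₃ c₂₊₃ c₂₋₃ i =
      affine⇒pandiagonal α₂ α₃ (α₁ * toℤ i) c₂ c₃ c₂₊₃ c₂₋₃
        (λ j k → ≈-trans (C-linear i j k) (≡⇒≈ (regroup (toℤ i) (toℤ j) (toℤ k))))
      where
      regroup : ∀ x y z → α₁ * x + α₂ * y + α₃ * z ≡ α₂ * y + α₃ * z + α₁ * x
      regroup x y z = solve (x ∷ y ∷ z ∷ α₁ ∷ α₂ ∷ α₃ ∷ [])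

    slice₂-pandiagonal : Coprime α₁ → Coprime α₃ → Coprime (α₁ + α₃) → Coprime (α₁ - α₃) →
                         ∀ j → PandiagonalLatinSquare n (λ i k → C i j k)
    slice₂-pandiagonal c₁ c₃ c₁₊₃ c₁₋₃ j =
      affine⇒pandiagonal α₁ α₃ (α₂ * toℤ j) c₁ c₃ c₁₊₃ c₁₋₃
        (λ i k → ≈-trans (C-linear i j k) (≡⇒≈ (regroup (toℤ i) (toℤ j) (toℤ k))))
      where
      regroup : ∀ x y z → α₁ * x + α₂ * y + α₃ * z ≡ α₁ * x + α₃ * z + α₂ * y
      regroup x y z = solve (x ∷ y ∷ z ∷ α₁ ∷ α₂ ∷ α₃ ∷ [])

    slice₃-pandiagonal : Coprime α₁ → Coprime α₂ → Coprime (α₁ + α₂) → Coprime (α₁ - α₂) →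
                         ∀ k → PandiagonalLatinSquare n (λ i j → C i j k)
    slice₃-pandiagonal c₁ c₂ c₁₊₂ c₁₋₂ k =
      affine⇒pandiagonal α₁ α₂ (α₃ * toℤ k) c₁ c₂ c₁₊₂ c₁₋₂ (λ i j → C-linear i j k)

    diagonal₁₂-pandiagonal : Coprime (α₁ + α₂) → Coprime α₃ → Coprime A → Coprime (A - + 2 * α₃) →
                             PandiagonalLatinSquare n (λ i k → C i i k)
    diagonal₁₂-pandiagonal c₁₊₂ c₃ cA cA₋₃ =
      affine⇒pandiagonal (α₁ + α₂) α₃ 0ℤ c₁₊₂ c₃ cA (subst Coprime A-2α₃≡ cA₋₃)
        (λ i k → ≈-trans (C-linear i i k) (≡⇒≈ (regroup (toℤ i) (toℤ k))))
      where
      regroup : ∀ x y → α₁ * x + α₂ * x + α₃ * y ≡ (α₁ + α₂) * x + α₃ * y + 0ℤ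
      regroup x y = solve (x ∷ y ∷ α₁ ∷ α₂ ∷ α₃ ∷ [])

      A-2α₃≡ : α₁ + α₂ + α₃ - + 2 * α₃ ≡ α₁ + α₂ - α₃
      A-2α₃≡ = solve (α₁ ∷ α₂ ∷ α₃ ∷ [])

    antidiagonal₁₂-pandiagonal : Coprime (α₁ - α₂) → Coprime α₃ →
                                 Coprime (A - + 2 * α₂) → Coprime (A - + 2 * α₁) →
                                 PandiagonalLatinSquare n (λ i k → C i (opposite i) k)
    antidiagonal₁₂-pandiagonal c₁₋₂ c₃ cA₋₂ cA₋₁ =
      affine⇒pandiagonal (α₁ - α₂) α₃ (- α₂) c₁₋₂ c₃
        (subst Coprime A-2α₂≡ cA₋₂) (Coprime-neg -[A-2α₁]≡ cA₋₁)
        (λ i k → ≈-trans (C-linear-cong ≈-refl (toℤ-opposite i) ≈-refl)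
                           (≡⇒≈ (regroup (toℤ i) (toℤ k))))
      where
      regroup : ∀ x y → α₁ * x + α₂ * (-1ℤ - x) + α₃ * y ≡ (α₁ - α₂) * x + α₃ * y + - α₂
      regroup x y = solve (x ∷ y ∷ α₁ ∷ α₂ ∷ α₃ ∷ [])

      A-2α₂≡ : α₁ + α₂ + α₃ - + 2 * α₂ ≡ α₁ - α₂ + α₃
      A-2α₂≡ = solve (α₁ ∷ α₂ ∷ α₃ ∷ [])

      -[A-2α₁]≡ : - (α₁ + α₂ + α₃ - + 2 * α₁) ≡ α₁ - α₂ - α₃
      -[A-2α₁]≡ = solve (α₁ ∷ α₂ ∷ α₃ ∷ [])

    diagonal₁₃-pandiagonal : Coprime (α₁ + α₃) → Coprime α₂ → Coprime A → Coprime (A - + 2 * α₂) →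
                             PandiagonalLatinSquare n (λ i j → C i j i)
    diagonal₁₃-pandiagonal c₁₊₃ c₂ cA cA₋₂ =
      affine⇒pandiagonal (α₁ + α₃) α₂ 0ℤ c₁₊₃ c₂ (subst Coprime A≡ cA) (subst Coprime A-2α₂≡ cA₋₂)
        (λ i j → ≈-trans (C-linear i j i) (≡⇒≈ (regroup (toℤ i) (toℤ j))))
      where
      regroup : ∀ x y → α₁ * x + α₂ * y + α₃ * x ≡ (α₁ + α₃) * x + α₂ * y + 0ℤ
      regroup x y = solve (x ∷ y ∷ α₁ ∷ α₂ ∷ α₃ ∷ [])

      A≡ : α₁ + α₂ + α₃ ≡ α₁ + α₃ + α₂
      A≡ = solve (α₁ ∷ α₂ ∷ α₃ ∷ [])

      A-2α₂≡ : α₁ + α₂ + α₃ - + 2 * α₂ ≡ α₁ + α₃ - α₂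
      A-2α₂≡ = solve (α₁ ∷ α₂ ∷ α₃ ∷ [])

    antidiagonal₁₃-pandiagonal : Coprime (α₁ - α₃) → Coprime α₂ →
                                 Coprime (A - + 2 * α₃) → Coprime (A - + 2 * α₁) →
                                 PandiagonalLatinSquare n (λ i j → C i j (opposite i))
    antidiagonal₁₃-pandiagonal c₁₋₃ c₂ cA₋₃ cA₋₁ =
      affine⇒pandiagonal (α₁ - α₃) α₂ (- α₃) c₁₋₃ c₂
        (subst Coprime A-2α₃≡ cA₋₃) (Coprime-neg -[A-2α₁]≡ cA₋₁)
        (λ i j → ≈-trans (C-linear-cong ≈-refl ≈-refl (toℤ-opposite i))
                           (≡⇒≈ (regroup (toℤ i) (toℤ j))))
      where
      regroup : ∀ x y → α₁ * x + α₂ * y + α₃ * (-1ℤ - x) ≡ (α₁ - α₃) * x + α₂ * y + - α₃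
      regroup x y = solve (x ∷ y ∷ α₁ ∷ α₂ ∷ α₃ ∷ [])

      A-2α₃≡ : α₁ + α₂ + α₃ - + 2 * α₃ ≡ α₁ - α₃ + α₂
      A-2α₃≡ = solve (α₁ ∷ α₂ ∷ α₃ ∷ [])

      -[A-2α₁]≡ : - (α₁ + α₂ + α₃ - + 2 * α₁) ≡ α₁ - α₃ - α₂
      -[A-2α₁]≡ = solve (α₁ ∷ α₂ ∷ α₃ ∷ [])

    diagonal₂₃-pandiagonal : Coprime α₁ → Coprime (α₂ + α₃) → Coprime A → Coprime (A - + 2 * α₁) →
                             PandiagonalLatinSquare n (λ i j → C i j j)
    diagonal₂₃-pandiagonal c₁ c₂₊₃ cA cA₋₁ =
      affine⇒pandiagonal α₁ (α₂ + α₃) 0ℤ c₁ c₂₊₃ (subst Coprime A≡ cA) (Coprime-neg -[A-2α₁]≡ cA₋₁)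
        (λ i j → ≈-trans (C-linear i j j) (≡⇒≈ (regroup (toℤ i) (toℤ j))))
      where
      regroup : ∀ x y → α₁ * x + α₂ * y + α₃ * y ≡ α₁ * x + (α₂ + α₃) * y + 0ℤ
      regroup x y = solve (x ∷ y ∷ α₁ ∷ α₂ ∷ α₃ ∷ [])

      A≡ : α₁ + α₂ + α₃ ≡ α₁ + (α₂ + α₃)
      A≡ = solve (α₁ ∷ α₂ ∷ α₃ ∷ [])

      -[A-2α₁]≡ : - (α₁ + α₂ + α₃ - + 2 * α₁) ≡ α₁ - (α₂ + α₃)
      -[A-2α₁]≡ = solve (α₁ ∷ α₂ ∷ α₃ ∷ [])

    antidiagonal₂₃-pandiagonal : Coprime α₁ → Coprime (α₂ - α₃) →
                                 Coprime (A - + 2 * α₃) → Coprime (A - + 2 * α₂) →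
                                 PandiagonalLatinSquare n (λ i j → C i j (opposite j))
    antidiagonal₂₃-pandiagonal c₁ c₂₋₃ cA₋₃ cA₋₂ =
      affine⇒pandiagonal α₁ (α₂ - α₃) (- α₃) c₁ c₂₋₃
        (subst Coprime A-2α₃≡ cA₋₃) (subst Coprime A-2α₂≡ cA₋₂)
        (λ i j → ≈-trans (C-linear-cong ≈-refl ≈-refl (toℤ-opposite j))
                           (≡⇒≈ (regroup (toℤ i) (toℤ j))))
      where
      regroup : ∀ x y → α₁ * x + α₂ * y + α₃ * (-1ℤ - y) ≡ α₁ * x + (α₂ - α₃) * y + - α₃
      regroup x y = solve (x ∷ y ∷ α₁ ∷ α₂ ∷ α₃ ∷ [])

      A-2α₃≡ : α₁ + α₂ + α₃ - + 2 * α₃ ≡ α₁ + (α₂ - α₃)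
      A-2α₃≡ = solve (α₁ ∷ α₂ ∷ α₃ ∷ [])

      A-2α₂≡ : α₁ + α₂ + α₃ - + 2 * α₂ ≡ α₁ - (α₂ - α₃)
      A-2α₂≡ = solve (α₁ ∷ α₂ ∷ α₃ ∷ [])

    pandiagonal : Coprime α₁ → Coprime α₂ → Coprime α₃ →
                  Coprime (α₁ + α₂) → Coprime (α₁ + α₃) → Coprime (α₂ + α₃) →
                  Coprime (α₁ - α₂) → Coprime (α₁ - α₃) → Coprime (α₂ - α₃) →
                  Coprime A →
                  Coprime (A - + 2 * α₁) → Coprime (A - + 2 * α₂) → Coprime (A - + 2 * α₃) →
                  PandiagonalLatinCube n C
    pandiagonal c₁ c₂ c₃ c₁₊₂ c₁₊₃ c₂₊₃ c₁₋₂ c₁₋₃ c₂₋₃ cA cA₋₁ cA₋₂ cA₋₃ =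
        slice₁-pandiagonal c₂ c₃ c₂₊₃ c₂₋₃
      , slice₂-pandiagonal c₁ c₃ c₁₊₃ c₁₋₃
      , slice₃-pandiagonal c₁ c₂ c₁₊₂ c₁₋₂
      , diagonal₁₂-pandiagonal c₁₊₂ c₃ cA cA₋₃
      , antidiagonal₁₂-pandiagonal c₁₋₂ c₃ cA₋₂ cA₋₁
      , diagonal₁₃-pandiagonal c₁₊₃ c₂ cA cA₋₂
      , antidiagonal₁₃-pandiagonal c₁₋₃ c₂ cA₋₃ cA₋₁
      , diagonal₂₃-pandiagonal c₁ c₂₊₃ cA cA₋₁
      , antidiagonal₂₃-pandiagonal c₁ c₂₋₃ cA₋₃ cA₋₂

  toℤ-linearCube : ∀ a₁ a₂ a₃ i j k →
                   toℤ (linearCube n a₁ a₂ a₃ i j k) ≈ + a₁ * toℤ i + + a₂ * toℤ j + + a₃ * toℤ k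
  toℤ-linearCube a₁ a₂ a₃ i j k = ≈-trans (toℤ-modN _) (≡⇒≈ (pos-linear (toℕ i) (toℕ j) (toℕ k)))
    where
    pos-linear : ∀ x y z →
                 + (a₁ ℕ.* x ℕ.+ a₂ ℕ.* y ℕ.+ a₃ ℕ.* z) ≡ + a₁ * + x + + a₂ * + y + + a₃ * + z
    pos-linear x y z = trans (ℤ.pos-+ (a₁ ℕ.* x ℕ.+ a₂ ℕ.* y) (a₃ ℕ.* z))
      (cong₂ _+_ (trans (ℤ.pos-+ (a₁ ℕ.* x) (a₂ ℕ.* y)) (cong₂ _+_ (ℤ.pos-* a₁ x) (ℤ.pos-* a₂ y)))
                 (ℤ.pos-* a₃ z))

mainTheorem5 : (m : ℕ) → let n = suc m in
    ¬ (2 ∣ n) →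
    (α₁ α₂ α₃ : ℕ) →
    1 ≤ α₁ → α₁ < n → 1 ≤ α₂ → α₂ < n → 1 ≤ α₃ → α₃ < n →
    gcd α₁ n ≡ 1 → gcd α₂ n ≡ 1 → gcd α₃ n ≡ 1 →
    gcd ∣ + α₁ +ℤ + α₂ ∣ n ≡ 1 → gcd ∣ + α₁ +ℤ + α₃ ∣ n ≡ 1 → gcd ∣ + α₂ +ℤ + α₃ ∣ n ≡ 1 →
    gcd ∣ + α₁ -ℤ + α₂ ∣ n ≡ 1 → gcd ∣ + α₁ -ℤ + α₃ ∣ n ≡ 1 → gcd ∣ + α₂ -ℤ + α₃ ∣ n ≡ 1 →
    gcd ∣ + α₁ +ℤ + α₂ +ℤ + α₃ ∣ n ≡ 1 →
    gcd ∣ (+ α₁ +ℤ + α₂ +ℤ + α₃) -ℤ + 2 *ℤ + α₁ ∣ n ≡ 1 →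
    gcd ∣ (+ α₁ +ℤ + α₂ +ℤ + α₃) -ℤ + 2 *ℤ + α₂ ∣ n ≡ 1 →
    gcd ∣ (+ α₁ +ℤ + α₂ +ℤ + α₃) -ℤ + 2 *ℤ + α₃ ∣ n ≡ 1 →
    PandiagonalLatinCube n (linearCube n α₁ α₂ α₃)
mainTheorem5 m _ α₁ α₂ α₃ _ _ _ _ _ _ =
  AffineCube.pandiagonal (+ α₁) (+ α₂) (+ α₃) (toℤ-linearCube α₁ α₂ α₃)
  where open Modulo (suc m)
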